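{- Let $G=(V,E)$ be a co-chordal graph with at least one vertex and let $\mathcal{T}$ be a clique tree of its complement $G^c$. Then the output of $\mathrm{FindPartition}(\mathcal{T})$ (for any choices of edges made during the recursion) is a biclique partition of $G$ of size $\operatorname{mc}(G^c)-1$.
   Context: Graphs are finite and simple; $G$ is co-chordal if $G^c$ is chordal (no induced cycle of length $>3$). $\operatorname{mc}(H)$ is the number of maximal cliques of $H$. A clique tree of a chordal graph $H$ is a tree whose vertices are exactly the maximal cliques of $H$ and which satisfies the clique-intersection property: for any two maximal cliques $K_1,K_2$, every clique on the tree path between $K_1$ and $K_2$ contains $V(K_1)\cap V(K_2)$. For an edge $e=K'K''$ of a clique tree, its middle set is $\operatorname{mid}(e)=V(K')\cap V(K'')$. A biclique $\{L,R\}$ is the complete bipartite graph with disjoint vertex sets $L,R$ and edge set $\{uv:u\in L,v\in R\}$; a biclique partition of $G$ is a collection of biclique subgraphs of $G$ such that every edge of $G$ lies in exactly one of them. The recursive procedure $\mathrm{FindPartition}(\mathcal{T})$: if $\mathcal{T}$ has at most one vertex, return $\emptyset$; otherwise choose an arbitrary edge $e$ of $\mathcal{T}$, whose removal splits $\mathcal{T}$ into two subtrees $\mathcal{T}_1,\mathcal{T}_2$; set $L=\bigcup_{K\in V(\mathcal{T}_1)}V(K)\setminus\operatorname{mid}(e)$ and $R=\bigcup_{K\in V(\mathcal{T}_2)}V(K)\setminus\operatorname{mid}(e)$; return $\{\{L,R\}\}\cup\mathrm{FindPartition}(\mathcal{T}_1)\cup\mathrm{FindPartition}(\mathcal{T}_2)$.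 -}

module Defs where

open import Data.Nat using (ℕ; zero; suc; _≤_; _∸_)
open import Data.Fin using (Fin; zero; suc; toℕ; fromℕ; inject₁; _≟_)
open import Data.Fin.Subset using (Subset; _∈_; _∉_; _⊆_; _∩_)
open import Data.Bool using (Bool; true; false; not; _∧_)
open import Data.List using (List; length; _∷_; []; _++_; lookup)
open import Data.List.Relation.Unary.Unique.Propositional using (Unique)
open import Data.List.Membership.Propositional using () renaming (_∈_ to _∈ₗ_)
open import Data.Product using (Σ; ∃; _×_; _,_)
open import Data.Sum using (_⊎_)
open import Relation.Nullary using (¬_; ⌊_⌋)
open import Relation.Binary.PropositionalEquality using (_≡_; _≢_)
open import Function.Definitions using (Injective)

Adj : ℕ → Set
Adj n = Fin n → Fin n → Bool

IsSimple : ∀ {n} → Adj n → Set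
IsSimple {n} E = (∀ (u v : Fin n) → E u v ≡ E v u) × (∀ (u : Fin n) → E u u ≡ false)

_ᶜ : ∀ {n} → Adj n → Adj n
(E ᶜ) u v = not (E u v) ∧ not ⌊ u ≟ v ⌋

CycAdj : ∀ {k} → Fin (suc k) → Fin (suc k) → Set
CycAdj {k} i j =
  (suc (toℕ i) ≡ toℕ j) ⊎ (suc (toℕ j) ≡ toℕ i)
  ⊎ (toℕ i ≡ 0 × toℕ j ≡ k) ⊎ (toℕ j ≡ 0 × toℕ i ≡ k)

-- an induced cycle c 0, ..., c k of length suc k in E
IsInducedCycle : ∀ {n} (E : Adj n) (k : ℕ) → (Fin (suc k) → Fin n) → Set
IsInducedCycle E k c =
  Injective _≡_ _≡_ c
  × (∀ i j → (E (c i) (c j) ≡ true → CycAdj i j) × (CycAdj i j → E (c i) (c j) ≡ true))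

-- chordal: no induced cycle of length > 3
IsChordal : ∀ {n} → Adj n → Set
IsChordal E = ∀ (k : ℕ) (c : Fin (suc k) → _) → 3 ≤ k → ¬ IsInducedCycle E k c

IsCoChordal : ∀ {n} → Adj n → Set
IsCoChordal E = IsChordal (E ᶜ)

IsPath : ∀ {m} (T : Adj m) (x y : Fin m) (k : ℕ) → (Fin (suc k) → Fin m) → Set
IsPath T x y k c =
  Injective _≡_ _≡_ c × c zero ≡ x × c (fromℕ k) ≡ y
  × (∀ (i : Fin k) → T (c (inject₁ i)) (c (suc i)) ≡ true)

IsCycle : ∀ {m} (T : Adj m) (k : ℕ) → (Fin (suc k) → Fin m) → Set
IsCycle T k c =
  Injective _≡_ _≡_ c
  × (∀ (i : Fin k) → T (c (inject₁ i)) (c (suc i)) ≡ true)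
  × T (c (fromℕ k)) (c zero) ≡ true

IsConnected : ∀ {m} → Adj m → Set
IsConnected T = ∀ x y → Σ ℕ λ k → Σ (Fin (suc k) → _) λ c → IsPath T x y k c

IsAcyclic : ∀ {m} → Adj m → Set
IsAcyclic T = ∀ (k : ℕ) (c : Fin (suc k) → _) → 2 ≤ k → ¬ IsCycle T k c

IsTree : ∀ {m} → Adj m → Set
IsTree T = IsSimple T × IsConnected T × IsAcyclic T

IsClique : ∀ {n} → Adj n → Subset n → Set
IsClique E S = ∀ u v → u ∈ S → v ∈ S → u ≢ v → E u v ≡ true

IsMaxClique : ∀ {n} → Adj n → Subset n → Set
IsMaxClique E S = IsClique E S × (∀ S' → IsClique E S' → S ⊆ S' → S' ≡ S)

NumMaxCliques : ∀ {n} → Adj n → ℕ → Set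
NumMaxCliques {n} E k =
  Σ (List (Subset n)) λ Ks → Unique Ks × length Ks ≡ k
    × (∀ S → (IsMaxClique E S → S ∈ₗ Ks) × (S ∈ₗ Ks → IsMaxClique E S))

-- Clique trees: a tree T on nodes Fin m, with node x labelled by the
-- maximal clique K x of H, the labelling being a bijection onto the set
-- of maximal cliques, satisfying the clique-intersection property.

IsCliqueTree : ∀ {n m} (H : Adj n) (T : Adj m) (K : Fin m → Subset n) → Set
IsCliqueTree {n} {m} H T K =
  IsTree T
  × Injective _≡_ _≡_ K
  × (∀ x → IsMaxClique H (K x))
  × (∀ S → IsMaxClique H S → ∃ λ x → K x ≡ S)
  × (∀ x y (k : ℕ) (c : Fin (suc k) → Fin m) → IsPath T x y k c →
       ∀ i → (K x ∩ K y) ⊆ K (c i))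

record Biclique (n : ℕ) : Set₁ where
  constructor biclique
  field
    L : Fin n → Set
    R : Fin n → Set

open Biclique public

EdgeIn : ∀ {n} → Biclique n → Fin n → Fin n → Set
EdgeIn B u v = (L B u × R B v) ⊎ (L B v × R B u)

IsBicliqueOf : ∀ {n} → Adj n → Biclique n → Set
IsBicliqueOf E B =
  (∀ v → L B v → R B v → Data.Empty.⊥)
  × (∀ u v → L B u → R B v → E u v ≡ true)
  where import Data.Empty

IsBicliquePartition : ∀ {n} → Adj n → List (Biclique n) → Set
IsBicliquePartition E P =
  (∀ i → IsBicliqueOf E (lookup P i))
  × (∀ u v → E u v ≡ true →
       Σ _ λ i → EdgeIn (lookup P i) u v × (∀ j → EdgeIn (lookup P j) u v → j ≡ i))

-- FindPartition, as a relation "P is a possible output" (covering all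
-- choices of edges).  Subtrees of the fixed clique tree (T , K) are
-- represented by their node sets S : Fin m → Set.

data ReachAvoid {m} (T : Adj m) (S : Fin m → Set) (a b s : Fin m) : Fin m → Set where
  here : S s → ReachAvoid T S a b s s
  step : ∀ {x y} → ReachAvoid T S a b s x → S y → T x y ≡ true →
         ¬ ((x ≡ a × y ≡ b) ⊎ (x ≡ b × y ≡ a)) → ReachAvoid T S a b s y

-- vertex v lies in (the union of the cliques of the subtree S) minus mid(ab)
SideSet : ∀ {n m} (K : Fin m → Subset n) (S : Fin m → Set) (a b : Fin m) → Fin n → Set
SideSet K S a b v = (∃ λ x → S x × v ∈ K x) × ¬ (v ∈ K a × v ∈ K b)

data FindPartition {n m} (T : Adj m) (K : Fin m → Subset n) :
       (Fin m → Set) → List (Biclique n) → Set₁ where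
  small : ∀ {S} → (∀ x y → S x → S y → x ≡ y) → FindPartition T K S []
  split : ∀ {S P₁ P₂} (a b : Fin m) → S a → S b → T a b ≡ true →
          FindPartition T K (ReachAvoid T S a b a) P₁ →
          FindPartition T K (ReachAvoid T S a b b) P₂ →
          FindPartition T K S
            (biclique (SideSet K (ReachAvoid T S a b a) a b)
                      (SideSet K (ReachAvoid T S a b b) a b) ∷ P₁ ++ P₂)

-- Removing an edge ab of the clique tree splits it into two subtrees with
-- node sets A and B, and by the clique-intersection property every vertex
-- lying in a clique of A and in a clique of B lies in mid(ab).  Hence the
-- first biclique {L,R} is a subgraph of G: if u ∈ L and v ∈ R were not
-- adjacent in G, they would lie in a common maximal clique of Gᶜ, i.e. in a
-- clique of A or of B, forcing u or v into mid(ab).  An edge uv of G has its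
-- endpoints in no common clique, so at most one endpoint is in mid(ab), and a
-- case analysis shows that uv lies in exactly one of: {L,R}, the part over A,
-- the part over B; the recursion then finds it exactly once.  Finally each
-- split adds one biclique and one tree node, and the nodes are the mc(Gᶜ)
-- maximal cliques.
module Submission where

open import Level using (_⊔_; 0ℓ)
open import Function using (_∘_)
open import Data.Empty using (⊥; ⊥-elim)
open import Data.Unit using (⊤; tt)
open import Data.Product using (Σ; ∃; _×_; _,_; proj₁; proj₂)
open import Data.Sum as Sum using (_⊎_; inj₁; inj₂)
open import Data.Bool using (true; false; not; _∧_)
import Data.Bool as Bool
open import Data.Nat using (ℕ; zero; suc; _+_; _∸_; z≤n; s≤s)
open import Data.Nat.Properties using (+-suc)
open import Data.Fin using (Fin; zero; suc; fromℕ; inject₁; _≟_)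
open import Data.Fin.Properties using (any?; all?; suc-injective)
open import Data.Fin.Subset using (Subset; _∈_; _∉_; _⊆_; _∩_; _∪_; ⁅_⁆; _⊃_)
open import Data.Fin.Subset.Properties
  using (_∈?_; ⊆-antisym; x∈⁅x⁆; x∈⁅y⁆⇒x≡y; x∈p∪q⁺; x∈p∪q⁻; p⊆p∪q; x∈p∩q⁺)
open import Data.Fin.Subset.Induction using (⊃-wellFounded)
open import Induction.WellFounded using (Acc; acc)
open import Data.List using (List; []; _∷_; _++_; length; lookup; map)
open import Data.List.Properties using (length-map; length-++)
open import Data.List.Relation.Unary.All as All using (All; []; _∷_)
open import Data.List.Relation.Unary.All.Properties using (++⁺)
open import Data.List.Relation.Unary.AllPairs using ([]; _∷_)
open import Data.List.Relation.Unary.Any using (here)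
open import Data.List.Relation.Unary.Unique.Propositional using (Unique)
import Data.List.Relation.Unary.Unique.Propositional.Properties as Unique
open import Data.List.Membership.Propositional using () renaming (_∈_ to _∈ₗ_)
open import Data.List.Membership.Propositional.Properties
  using (∈-++⁺ˡ; ∈-++⁺ʳ; ∈-++⁻; ∈-map⁺; ∈-map⁻; ∈-lookup)
open import Relation.Binary.Core using (Rel)
open import Relation.Binary.Definitions using (DecidableEquality)
open import Relation.Binary.Construct.Closure.ReflexiveTransitive
  using (Star; ε; _◅_; _◅◅_; reverse)
open import Relation.Binary.PropositionalEquality
open import Relation.Nullary using (¬_; Dec; yes; no; ⌊_⌋; contradiction)
open import Relation.Nullary.Decidable using (_×-dec_; _⊎-dec_; _→-dec_; ¬?)
open import Function.Definitions using (Injective)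

open import Defs

data ExactlyOne {a p} {A : Set a} (Q : A → Set p) : List A → Set (a ⊔ p) where
  hit  : ∀ {x xs} → Q x → All (¬_ ∘ Q) xs → ExactlyOne Q (x ∷ xs)
  miss : ∀ {x xs} → ¬ Q x → ExactlyOne Q xs → ExactlyOne Q (x ∷ xs)

module _ {a p} {A : Set a} {Q : A → Set p} where

  ExactlyOne-++ˡ : ∀ {xs ys} → ExactlyOne Q xs → All (¬_ ∘ Q) ys → ExactlyOne Q (xs ++ ys)
  ExactlyOne-++ˡ (hit q none) none′ = hit q (++⁺ none none′)
  ExactlyOne-++ˡ (miss ¬q one) none′ = miss ¬q (ExactlyOne-++ˡ one none′)

  ExactlyOne-++ʳ : ∀ {xs ys} → All (¬_ ∘ Q) xs → ExactlyOne Q ys → ExactlyOne Q (xs ++ ys)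
  ExactlyOne-++ʳ [] one = one
  ExactlyOne-++ʳ (¬q ∷ none) one = miss ¬q (ExactlyOne-++ʳ none one)

  ExactlyOne⇒unique-index : ∀ {xs} → ExactlyOne Q xs →
    Σ (Fin (length xs)) λ i → Q (lookup xs i) × (∀ j → Q (lookup xs j) → j ≡ i)
  ExactlyOne⇒unique-index (hit q none) = zero , q , λ where
    zero _ → refl
    (suc j) qj → contradiction qj (All.lookup none (∈-lookup j))
  ExactlyOne⇒unique-index (miss ¬q one) with ExactlyOne⇒unique-index one
  ... | i , q , unique = suc i , q , λ where
    zero qj → contradiction qj ¬q
    (suc j) qj → cong suc (unique j qj)

record Listing {A : Set} (S : A → Set) (l : ℕ) : Set where
  field
    elements : List A
    unique   : Unique elements
    complete : ∀ {x} → S x → x ∈ₗ elements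
    sound    : ∀ {x} → x ∈ₗ elements → S x
    size     : length elements ≡ l

module _ {A : Set} where

  listing-singleton : ∀ {S : A → Set} {s} → S s → (∀ x y → S x → S y → x ≡ y) → Listing S 1
  listing-singleton {s = s} Ss single = record
    { elements = s ∷ []
    ; unique   = [] ∷ []
    ; complete = λ Sx → here (single _ s Sx Ss)
    ; sound    = λ { (here refl) → Ss }
    ; size     = refl
    }

  listing-union : ∀ {S S₁ S₂ : A → Set} {l₁ l₂} → Listing S₁ l₁ → Listing S₂ l₂ →
    (∀ {x} → S₁ x → S₂ x → ⊥) → (∀ {x} → S x → S₁ x ⊎ S₂ x) →
    (∀ {x} → S₁ x → S x) → (∀ {x} → S₂ x → S x) → Listing S (l₁ + l₂)
  listing-union ls₁ ls₂ disjoint cover S₁⊆S S₂⊆S = record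
    { elements = xs₁ ++ xs₂
    ; unique   = Unique.++⁺ L₁.unique L₂.unique
                   (λ (x∈₁ , x∈₂) → disjoint (L₁.sound x∈₁) (L₂.sound x∈₂))
    ; complete = λ Sx → Sum.[ ∈-++⁺ˡ ∘ L₁.complete , ∈-++⁺ʳ xs₁ ∘ L₂.complete ]′ (cover Sx)
    ; sound    = λ x∈ → Sum.[ S₁⊆S ∘ L₁.sound , S₂⊆S ∘ L₂.sound ]′ (∈-++⁻ xs₁ x∈)
    ; size     = trans (length-++ xs₁) (cong₂ _+_ L₁.size L₂.size)
    }
    where
    module L₁ = Listing ls₁
    module L₂ = Listing ls₂
    xs₁ = L₁.elements
    xs₂ = L₂.elements

-- Loop erasure

module LoopErasure {A : Set} (_≟ᴬ_ : DecidableEquality A) {r} {R : Rel A r} where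

  steps : ∀ {x y} → Star R x y → ℕ
  steps ε = 0
  steps (_ ◅ w) = suc (steps w)

  vertex : ∀ {x y} (w : Star R x y) → Fin (suc (steps w)) → A
  vertex {x} _ zero = x
  vertex ε (suc ())
  vertex (_ ◅ w) (suc i) = vertex w i

  vertex-last : ∀ {x y} (w : Star R x y) → vertex w (fromℕ (steps w)) ≡ y
  vertex-last ε = refl
  vertex-last (_ ◅ w) = vertex-last w

  vertex-link : ∀ {x y} (w : Star R x y) (i : Fin (steps w)) →
    R (vertex w (inject₁ i)) (vertex w (suc i))
  vertex-link (r ◅ _) zero = r
  vertex-link (_ ◅ w) (suc i) = vertex-link w i

  Simple : ∀ {x y} → Star R x y → Set
  Simple w = Injective _≡_ _≡_ (vertex w)

  simple-◅ : ∀ {x y z} {r : R x y} {w : Star R y z} →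
    Simple w → (∀ i → vertex w i ≢ x) → Simple (r ◅ w)
  simple-◅ simple fresh {zero} {zero} _ = refl
  simple-◅ simple fresh {zero} {suc j} eq = contradiction (sym eq) (fresh j)
  simple-◅ simple fresh {suc i} {zero} eq = contradiction eq (fresh i)
  simple-◅ simple fresh {suc i} {suc j} eq = cong suc (simple eq)

  suffix : ∀ {x y} (w : Star R x y) (i : Fin (suc (steps w))) →
    Simple w → Σ (Star R (vertex w i) y) Simple
  suffix w zero simple = w , simple
  suffix (_ ◅ w) (suc i) simple = suffix w i (suc-injective ∘ simple)

  erase : ∀ {x y} → Star R x y → Σ (Star R x y) Simple
  erase ε = ε , λ { {zero} {zero} _ → refl }
  erase {x} {y} (r ◅ w) with erase w
  ... | w′ , simple with any? (λ i → vertex w′ i ≟ᴬ x)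
  ... | yes (i , vᵢ≡x) = subst (λ z → Σ (Star R z y) Simple) vᵢ≡x (suffix w′ i simple)
  ... | no x∉w′ = r ◅ w′ , simple-◅ simple (λ i eq → x∉w′ (i , eq))

-- Maximal cliques

∪-⁅⁆-⊃ : ∀ {n} {C : Subset n} {w} → w ∉ C → (C ∪ ⁅ w ⁆) ⊃ C
∪-⁅⁆-⊃ {w = w} w∉C = p⊆p∪q ⁅ w ⁆ , w , x∈p∪q⁺ (inj₂ (x∈⁅x⁆ w)) , w∉C

module _ {n} (H : Adj n) where

  clique? : ∀ C → Dec (IsClique H C)
  clique? C = all? λ u → all? λ v →
    (u ∈? C) →-dec (v ∈? C) →-dec ¬? (u ≟ v) →-dec (H u v Bool.≟ true)

  ⊆-clique : ∀ {C D} → C ⊆ D → IsClique H D → IsClique H C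
  ⊆-clique C⊆D D-clique u v u∈C v∈C = D-clique u v (C⊆D u∈C) (C⊆D v∈C)

  unextendable⇒maximal : ∀ {C} → IsClique H C →
    ¬ (∃ λ w → w ∉ C × IsClique H (C ∪ ⁅ w ⁆)) → IsMaxClique H C
  unextendable⇒maximal {C} C-clique unextendable =
    C-clique , λ D D-clique C⊆D → ⊆-antisym (D⊆C D-clique C⊆D) C⊆D
    where
    D⊆C : ∀ {D} → IsClique H D → C ⊆ D → D ⊆ C
    D⊆C {D} D-clique C⊆D {w} w∈D with w ∈? C
    ... | yes w∈C = w∈C
    ... | no w∉C = contradiction (w , w∉C , ⊆-clique C+w⊆D D-clique) unextendable
      where
      C+w⊆D : (C ∪ ⁅ w ⁆) ⊆ D
      C+w⊆D x∈ with x∈p∪q⁻ C ⁅ w ⁆ x∈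
      ... | inj₁ x∈C = C⊆D x∈C
      ... | inj₂ x∈w = subst (_∈ D) (sym (x∈⁅y⁆⇒x≡y w x∈w)) w∈D

  extend-to-maximal′ : ∀ C → Acc _⊃_ C → IsClique H C → ∃ λ D → IsMaxClique H D × C ⊆ D
  extend-to-maximal′ C (acc smaller) C-clique
    with any? (λ w → ¬? (w ∈? C) ×-dec clique? (C ∪ ⁅ w ⁆))
  ... | no unextendable = C , unextendable⇒maximal C-clique unextendable , λ x∈C → x∈C
  ... | yes (w , w∉C , C+w-clique)
    with extend-to-maximal′ (C ∪ ⁅ w ⁆) (smaller (∪-⁅⁆-⊃ w∉C)) C+w-clique
  ...   | D , D-max , C+w⊆D = D , D-max , λ x∈C → C+w⊆D (p⊆p∪q ⁅ w ⁆ x∈C)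

  extend-to-maximal : ∀ {C} → IsClique H C → ∃ λ D → IsMaxClique H D × C ⊆ D
  extend-to-maximal {C} = extend-to-maximal′ C (⊃-wellFounded C)

  pair-clique : ∀ {u v} → (u ≢ v → H u v ≡ true × H v u ≡ true) → IsClique H (⁅ u ⁆ ∪ ⁅ v ⁆)
  pair-clique {u} {v} adjacent p q p∈ q∈ p≢q with ∈-pair p∈ | ∈-pair q∈
    where
    ∈-pair : ∀ {w} → w ∈ ⁅ u ⁆ ∪ ⁅ v ⁆ → w ≡ u ⊎ w ≡ v
    ∈-pair w∈ = Sum.map (x∈⁅y⁆⇒x≡y u) (x∈⁅y⁆⇒x≡y v) (x∈p∪q⁻ ⁅ u ⁆ ⁅ v ⁆ w∈)
  ... | inj₁ refl | inj₁ refl = contradiction refl p≢q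
  ... | inj₁ refl | inj₂ refl = proj₁ (adjacent p≢q)
  ... | inj₂ refl | inj₁ refl = proj₂ (adjacent (p≢q ∘ sym))
  ... | inj₂ refl | inj₂ refl = contradiction refl p≢q

module _ {n} (G : Adj n) {u v : Fin n} where

  ᶜ-adjacent : G u v ≡ false → u ≢ v → (G ᶜ) u v ≡ true
  ᶜ-adjacent non-edge u≢v with u ≟ v
  ... | yes u≡v = contradiction u≡v u≢v
  ... | no _ = cong (λ s → not s ∧ true) non-edge

  ᶜ-non-adjacent : G u v ≡ true → (G ᶜ) u v ≡ false
  ᶜ-non-adjacent edge = cong (λ s → not s ∧ not ⌊ u ≟ v ⌋) edge

-- Cutting a tree at an edge

module Tree {m} (T : Adj m) (T-sym : ∀ x y → T x y ≡ T y x) (T-irrefl : ∀ x → T x x ≡ false) where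

  Link : (Fin m → Set) → Rel (Fin m) 0ℓ
  Link S x y = S x × S y × T x y ≡ true

  link-flip : ∀ {S x y} → Link S x y → Link S y x
  link-flip {x = x} {y} (Sx , Sy , t) = Sy , Sx , trans (T-sym y x) t

  Connected : (Fin m → Set) → Set
  Connected S = ∀ {x y} → S x → S y → Star (Link S) x y

  path-walk : ∀ k (c : Fin (suc k) → Fin m) → (∀ i → T (c (inject₁ i)) (c (suc i)) ≡ true) →
    Star (Link (λ _ → ⊤)) (c zero) (c (fromℕ k))
  path-walk zero c links = ε
  path-walk (suc k) c links = (tt , tt , links zero) ◅ path-walk k (c ∘ suc) (links ∘ suc)

  connected-⊤ : IsConnected T → Connected (λ _ → ⊤)
  connected-⊤ connected {x} {y} _ _ with connected x y
  ... | k , c , _ , c₀≡x , cₖ≡y , links = subst₂ (Star _) c₀≡x cₖ≡y (path-walk k c links)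

  Crosses : Fin m → Fin m → Rel (Fin m) 0ℓ
  Crosses a b x y = (x ≡ a × y ≡ b) ⊎ (x ≡ b × y ≡ a)

  crosses? : ∀ a b x y → Dec (Crosses a b x y)
  crosses? a b x y = ((x ≟ a) ×-dec (y ≟ b)) ⊎-dec ((x ≟ b) ×-dec (y ≟ a))

  Avoiding : Fin m → Fin m → Rel (Fin m) 0ℓ
  Avoiding a b x y = T x y ≡ true × ¬ Crosses a b x y

  crosses-flip : ∀ {a b x y} → Crosses a b x y → Crosses a b y x
  crosses-flip (inj₁ (x≡a , y≡b)) = inj₂ (y≡b , x≡a)
  crosses-flip (inj₂ (x≡b , y≡a)) = inj₁ (y≡a , x≡b)

  avoiding-flip : ∀ {a b x y} → Avoiding a b x y → Avoiding a b y x
  avoiding-flip {x = x} {y} (t , ¬crosses) = trans (T-sym y x) t , ¬crosses ∘ crosses-flip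

  open LoopErasure (_≟_ {m})

  -- The loop-erased walk, closed up by the edge ab, is a cycle of length ≥ 3.
  no-detour : IsAcyclic T → ∀ {a b} → T a b ≡ true → Star (Avoiding a b) a b → ⊥
  no-detour acyclic {a} {b} tab w with erase w
  ... | ε , _ = contradiction (trans (sym tab) (T-irrefl a)) λ ()
  ... | (_ , ¬crosses) ◅ ε , _ = ¬crosses (inj₁ (refl , refl))
  ... | w′@(_ ◅ _ ◅ _) , simple =
    acyclic (steps w′) (vertex w′) (s≤s (s≤s z≤n)) (simple , proj₁ ∘ vertex-link w′ , closing)
    where
    closing : T (vertex w′ (fromℕ (steps w′))) a ≡ true
    closing = trans (cong (λ z → T z a) (vertex-last w′)) (trans (T-sym b a) tab)

  module Cut (acyclic : IsAcyclic T) (a b : Fin m) (tab : T a b ≡ true) where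

    Side : (Fin m → Set) → Fin m → Fin m → Set
    Side S = ReachAvoid T S a b

    side⊆ : ∀ {S s y} → Side S s y → S y
    side⊆ (here Sy) = Sy
    side⊆ (step _ Sy _ _) = Sy

    side-full : ∀ {S s y} → Side S s y → Side (λ _ → ⊤) s y
    side-full (here _) = here tt
    side-full (step r _ t ¬crosses) = step (side-full r) tt t ¬crosses

    side-walk : ∀ {S s y} → Side S s y → Star (Link (Side S s)) s y
    side-walk (here _) = ε
    side-walk (step r Sy t ¬crosses) = side-walk r ◅◅ ((r , step r Sy t ¬crosses , t) ◅ ε)

    side-connected : ∀ {S s} → Connected (Side S s)
    side-connected rx ry = reverse link-flip (side-walk rx) ◅◅ side-walk ry

    sides-cover : ∀ {S z} → S a → S b → Star (Link S) a z → Side S a z ⊎ Side S b z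
    sides-cover {S} Sa Sb = extend (inj₁ (here Sa))
      where
      extend-by-link : ∀ {x y} → Side S a x ⊎ Side S b x → Link S x y → Side S a y ⊎ Side S b y
      extend-by-link {x} {y} placed (_ , Sy , t) with crosses? a b x y
      ... | yes (inj₁ (_ , refl)) = inj₂ (here Sb)
      ... | yes (inj₂ (_ , refl)) = inj₁ (here Sa)
      ... | no ¬crosses = Sum.map (λ r → step r Sy t ¬crosses) (λ r → step r Sy t ¬crosses) placed

      extend : ∀ {x z} → Side S a x ⊎ Side S b x → Star (Link S) x z → Side S a z ⊎ Side S b z
      extend placed ε = placed
      extend placed (l ◅ w) = extend (extend-by-link placed l) w

    avoiding-walk : ∀ {S s y} → Side S s y → Star (Avoiding a b) s y
    avoiding-walk (here _) = ε
    avoiding-walk (step r _ t ¬crosses) = avoiding-walk r ◅◅ ((t , ¬crosses) ◅ ε)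

    sides-disjoint : ∀ {S S′ z} → Side S a z → Side S′ b z → ⊥
    sides-disjoint ra rb =
      no-detour acyclic tab (avoiding-walk ra ◅◅ reverse avoiding-flip (avoiding-walk rb))

    StaysOrCrosses : ∀ k → (Fin (suc k) → Fin m) → Set
    StaysOrCrosses k c = Side (λ _ → ⊤) a (c (fromℕ k)) ⊎ ∃ λ j → c (inject₁ j) ≡ a × c (suc j) ≡ b

    stays-or-crosses-suc : ∀ {k c} → StaysOrCrosses k (c ∘ suc) → StaysOrCrosses (suc k) c
    stays-or-crosses-suc = Sum.map₂ (λ (j , crossing) → suc j , crossing)

    path-stays-or-crosses : ∀ k (c : Fin (suc k) → Fin m) →
      (∀ i → T (c (inject₁ i)) (c (suc i)) ≡ true) → Side (λ _ → ⊤) a (c zero) → StaysOrCrosses k c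
    path-stays-or-crosses zero c links ra = inj₁ ra
    path-stays-or-crosses (suc k) c links ra with crosses? a b (c zero) (c (suc zero))
    ... | yes (inj₁ crossing) = inj₂ (zero , crossing)
    ... | yes (inj₂ (_ , c₁≡a)) = stays-or-crosses-suc {c = c}
      (path-stays-or-crosses k (c ∘ suc) (links ∘ suc) (subst (Side _ a) (sym c₁≡a) (here tt)))
    ... | no ¬crosses = stays-or-crosses-suc {c = c}
      (path-stays-or-crosses k (c ∘ suc) (links ∘ suc) (step ra tt (links zero) ¬crosses))

    path-crosses-cut : ∀ {x y k c} → IsPath T x y k c → Side (λ _ → ⊤) a x → Side (λ _ → ⊤) b y →
      ∃ λ j → c (inject₁ j) ≡ a × c (suc j) ≡ b
    path-crosses-cut {k = k} {c} (_ , c₀≡x , cₖ≡y , links) ra rb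
      with path-stays-or-crosses k c links (subst (Side _ a) (sym c₀≡x) ra)
    ... | inj₁ ra′ = ⊥-elim (sides-disjoint (subst (Side _ a) cₖ≡y ra′) rb)
    ... | inj₂ crossing = crossing

-- FindPartition on a clique tree of Gᶜ

module CliqueTree
  {n m} {G : Adj n} {T : Adj m} {K : Fin m → Subset n}
  (G-sym : ∀ u v → G u v ≡ G v u) (G-irrefl : ∀ u → G u u ≡ false)
  (T-sym : ∀ x y → T x y ≡ T y x) (T-irrefl : ∀ x → T x x ≡ false)
  (T-connected : IsConnected T) (T-acyclic : IsAcyclic T)
  (K-injective : Injective _≡_ _≡_ K)
  (K-maximal : ∀ x → IsMaxClique (G ᶜ) (K x))
  (K-onto : ∀ C → IsMaxClique (G ᶜ) C → ∃ λ x → K x ≡ C)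
  (K-intersection : ∀ x y k c → IsPath T x y k c → ∀ i → (K x ∩ K y) ⊆ K (c i))
  where

  open Tree T T-sym T-irrefl

  Over : (Fin m → Set) → Fin n → Set
  Over S w = ∃ λ x → S x × w ∈ K x

  BothOver : (Fin m → Set) → Fin n → Fin n → Set
  BothOver S u v = Over S u × Over S v

  over-mono : ∀ {S S′ w} → (∀ {x} → S x → S′ x) → Over S w → Over S′ w
  over-mono S⊆S′ (x , Sx , wx) = x , S⊆S′ Sx , wx

  both-over-mono : ∀ {S S′ u v} → (∀ {x} → S x → S′ x) → BothOver S u v → BothOver S′ u v
  both-over-mono S⊆S′ (over-u , over-v) = over-mono S⊆S′ over-u , over-mono S⊆S′ over-v

  G-adjacent⇒≢ : ∀ {u v} → G u v ≡ true → u ≢ v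
  G-adjacent⇒≢ {u} edge refl = contradiction (trans (sym edge) (G-irrefl u)) λ ()

  no-clique-contains-edge : ∀ {u v x} → G u v ≡ true → u ∈ K x → v ∈ K x → ⊥
  no-clique-contains-edge {u} {v} {x} edge ux vx =
    contradiction (trans (sym (ᶜ-non-adjacent G edge))
                         (proj₁ (K-maximal x) u v ux vx (G-adjacent⇒≢ edge))) λ ()

  non-edge-clique : ∀ {u v} → (u ≢ v → G u v ≡ false) → IsClique (G ᶜ) (⁅ u ⁆ ∪ ⁅ v ⁆)
  non-edge-clique {u} {v} non-edge = pair-clique (G ᶜ) λ u≢v →
    ᶜ-adjacent G (non-edge u≢v) u≢v , ᶜ-adjacent G (trans (G-sym v u) (non-edge u≢v)) (u≢v ∘ sym)

  co-clique : ∀ {u v} → (u ≢ v → G u v ≡ false) → ∃ λ x → u ∈ K x × v ∈ K x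
  co-clique {u} {v} non-edge with extend-to-maximal (G ᶜ) (non-edge-clique non-edge)
  ... | C , C-max , pair⊆C with K-onto C C-max
  ...   | x , refl = x , pair⊆C (x∈p∪q⁺ (inj₁ (x∈⁅x⁆ u))) , pair⊆C (x∈p∪q⁺ (inj₂ (x∈⁅x⁆ v)))

  over-⊤ : ∀ u → Over (λ _ → ⊤) u
  over-⊤ u = let (x , ux , _) = co-clique {u} {u} (λ u≢u → contradiction refl u≢u) in x , tt , ux

  module AtCut (a b : Fin m) (tab : T a b ≡ true) where

    open Cut T-acyclic a b tab public

    Mid : Fin n → Set
    Mid w = w ∈ K a × w ∈ K b

    cut-biclique : (Fin m → Set) → Biclique n
    cut-biclique S = biclique (SideSet K (Side S a) a b) (SideSet K (Side S b) a b)

    over-both-sides⇒mid : ∀ {S S′ w} → Over (Side S a) w → Over (Side S′ b) w → Mid w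
    over-both-sides⇒mid {w = w} (x , ra , wx) (y , rb , wy)
      with T-connected x y
    ... | k , c , path with path-crosses-cut path (side-full ra) (side-full rb)
    ...   | j , cⱼ≡a , cⱼ₊₁≡b =
      subst (λ z → w ∈ K z) cⱼ≡a (K-intersection x y k c path (inject₁ j) wxy) ,
      subst (λ z → w ∈ K z) cⱼ₊₁≡b (K-intersection x y k c path (suc j) wxy)
      where
      wxy = x∈p∩q⁺ (wx , wy)

    every-node-on-a-side : ∀ z → Side (λ _ → ⊤) a z ⊎ Side (λ _ → ⊤) b z
    every-node-on-a-side z = sides-cover tt tt (connected-⊤ T-connected tt tt)

    cut-biclique-valid : ∀ {S} → IsBicliqueOf G (cut-biclique S)
    cut-biclique-valid = (λ w (over-a , ¬mid) (over-b , _) → ¬mid (over-both-sides⇒mid over-a over-b))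
                       , adjacent
      where
      adjacent : ∀ {S} u v → SideSet K (Side S a) a b u → SideSet K (Side S b) a b v → G u v ≡ true
      adjacent u v (over-a , ¬mid-u) (over-b , ¬mid-v) with G u v in G-uv
      ... | true = refl
      ... | false with co-clique {u} {v} (λ _ → G-uv)
      ...   | x , ux , vx with every-node-on-a-side x
      ...     | inj₁ ra = contradiction (over-both-sides⇒mid (x , ra , vx) over-b) ¬mid-v
      ...     | inj₂ rb = contradiction (over-both-sides⇒mid over-a (x , rb , ux)) ¬mid-u

    data Place (S : Fin m → Set) (w : Fin n) : Set where
      left   : SideSet K (Side S a) a b w → Place S w
      right  : SideSet K (Side S b) a b w → Place S w
      middle : Mid w → Place S w

    place : ∀ {S w} → S a → S b → Connected S → Over S w → Place S w
    place {w = w} Sa Sb connected (x , Sx , wx) with (w ∈? K a) ×-dec (w ∈? K b)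
    ... | yes mid = middle mid
    ... | no ¬mid with sides-cover Sa Sb (connected Sa Sx)
    ...   | inj₁ ra = left ((x , ra , wx) , ¬mid)
    ...   | inj₂ rb = right ((x , rb , wx) , ¬mid)

    EdgeInCut : (Fin m → Set) → Fin n → Fin n → Set
    EdgeInCut S = EdgeIn (cut-biclique S)

    mid-over-a : ∀ {S w} → S a → w ∈ K a → Over (Side S a) w
    mid-over-a Sa wa = a , here Sa , wa

    mid-over-b : ∀ {S w} → S b → w ∈ K b → Over (Side S b) w
    mid-over-b Sb wb = b , here Sb , wb

    edge-lands : ∀ {S u v} → S a → S b → G u v ≡ true → Place S u → Place S v →
      EdgeInCut S u v ⊎ BothOver (Side S a) u v ⊎ BothOver (Side S b) u v
    edge-lands Sa Sb edge = λ where
      (left lu)   (left lv)   → inj₂ (inj₁ (proj₁ lu , proj₁ lv))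
      (left lu)   (right rv)  → inj₁ (inj₁ (lu , rv))
      (left lu)   (middle mv) → inj₂ (inj₁ (proj₁ lu , mid-over-a Sa (proj₁ mv)))
      (right ru)  (left lv)   → inj₁ (inj₂ (lv , ru))
      (right ru)  (right rv)  → inj₂ (inj₂ (proj₁ ru , proj₁ rv))
      (right ru)  (middle mv) → inj₂ (inj₂ (proj₁ ru , mid-over-b Sb (proj₂ mv)))
      (middle mu) (left lv)   → inj₂ (inj₁ (mid-over-a Sa (proj₁ mu) , proj₁ lv))
      (middle mu) (right rv)  → inj₂ (inj₂ (mid-over-b Sb (proj₂ mu) , proj₁ rv))
      (middle mu) (middle mv) → ⊥-elim (no-clique-contains-edge edge (proj₁ mu) (proj₁ mv))

    cut-edge-over : ∀ {S u v} → EdgeInCut S u v → BothOver S u v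
    cut-edge-over (inj₁ ((over-u , _) , (over-v , _))) = over-mono side⊆ over-u , over-mono side⊆ over-v
    cut-edge-over (inj₂ ((over-v , _) , (over-u , _))) = over-mono side⊆ over-u , over-mono side⊆ over-v

    cut-edge-not-within-a : ∀ {S S′ u v} → EdgeInCut S u v → ¬ BothOver (Side S′ a) u v
    cut-edge-not-within-a (inj₁ (_ , (over-b , ¬mid))) (_ , over-a) = ¬mid (over-both-sides⇒mid over-a over-b)
    cut-edge-not-within-a (inj₂ (_ , (over-b , ¬mid))) (over-a , _) = ¬mid (over-both-sides⇒mid over-a over-b)

    cut-edge-not-within-b : ∀ {S S′ u v} → EdgeInCut S u v → ¬ BothOver (Side S′ b) u v
    cut-edge-not-within-b (inj₁ ((over-a , ¬mid) , _)) (over-b , _) = ¬mid (over-both-sides⇒mid over-a over-b)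
    cut-edge-not-within-b (inj₂ ((over-a , ¬mid) , _)) (_ , over-b) = ¬mid (over-both-sides⇒mid over-a over-b)

    edge-not-within-both-sides : ∀ {S S′ u v} → G u v ≡ true →
      BothOver (Side S a) u v → BothOver (Side S′ b) u v → ⊥
    edge-not-within-both-sides edge (ua , va) (ub , vb) =
      no-clique-contains-edge edge (proj₁ (over-both-sides⇒mid ua ub)) (proj₁ (over-both-sides⇒mid va vb))

    none-outside : ∀ {S u v} {P : List (Biclique n)} → All (λ B → EdgeIn B u v → BothOver S u v) P →
      ¬ BothOver S u v → All (λ B → ¬ EdgeIn B u v) P
    none-outside confined outside = All.map (λ over → outside ∘ over) confined

    exactly-one-after-cut : ∀ {S u v} {P₁ P₂ : List (Biclique n)} → Connected S → S a → S b →
      G u v ≡ true → Over S u → Over S v →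
      (BothOver (Side S a) u v → ExactlyOne (λ B → EdgeIn B u v) P₁) →
      All (λ B → EdgeIn B u v → BothOver (Side S a) u v) P₁ →
      (BothOver (Side S b) u v → ExactlyOne (λ B → EdgeIn B u v) P₂) →
      All (λ B → EdgeIn B u v → BothOver (Side S b) u v) P₂ →
      ExactlyOne (λ B → EdgeIn B u v) (cut-biclique S ∷ P₁ ++ P₂)
    exactly-one-after-cut connected Sa Sb edge over-u over-v exactly₁ confined₁ exactly₂ confined₂
      with edge-lands Sa Sb edge (place Sa Sb connected over-u) (place Sa Sb connected over-v)
    ... | inj₁ in-cut = hit in-cut (++⁺ (none-outside confined₁ (cut-edge-not-within-a in-cut))
                                       (none-outside confined₂ (cut-edge-not-within-b in-cut)))
    ... | inj₂ (inj₁ in-a) = miss (λ in-cut → cut-edge-not-within-a in-cut in-a)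
      (ExactlyOne-++ˡ (exactly₁ in-a) (none-outside confined₂ (edge-not-within-both-sides edge in-a)))
    ... | inj₂ (inj₂ in-b) = miss (λ in-cut → cut-edge-not-within-b in-cut in-b)
      (ExactlyOne-++ʳ (none-outside confined₁ (λ in-a → edge-not-within-both-sides edge in-a in-b))
                      (exactly₂ in-b))

  find-partition-bicliques : ∀ {S P} → FindPartition T K S P → All (IsBicliqueOf G) P
  find-partition-bicliques (small _) = []
  find-partition-bicliques (split a b _ _ tab d₁ d₂) =
    AtCut.cut-biclique-valid a b tab ∷ ++⁺ (find-partition-bicliques d₁) (find-partition-bicliques d₂)

  find-partition-confined : ∀ {S P u v} → FindPartition T K S P →
    All (λ B → EdgeIn B u v → BothOver S u v) P
  find-partition-confined (small _) = []
  find-partition-confined (split a b _ _ tab d₁ d₂) =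
    cut-edge-over ∷ ++⁺ (All.map (both-over-mono side⊆ ∘_) (find-partition-confined d₁))
                        (All.map (both-over-mono side⊆ ∘_) (find-partition-confined d₂))
    where open AtCut a b tab

  find-partition-exactly-one : ∀ {S P u v} → FindPartition T K S P → Connected S → G u v ≡ true →
    Over S u → Over S v → ExactlyOne (λ B → EdgeIn B u v) P
  find-partition-exactly-one (small single) _ edge (x , Sx , ux) (y , Sy , vy) =
    ⊥-elim (no-clique-contains-edge edge ux (subst (λ z → _ ∈ K z) (single y x Sy Sx) vy))
  find-partition-exactly-one (split a b Sa Sb tab d₁ d₂) connected edge over-u over-v =
    exactly-one-after-cut connected Sa Sb edge over-u over-v
      (λ (ua , va) → find-partition-exactly-one d₁ side-connected edge ua va) (find-partition-confined d₁)
      (λ (ub , vb) → find-partition-exactly-one d₂ side-connected edge ub vb) (find-partition-confined d₂)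
    where open AtCut a b tab

  find-partition-listing : ∀ {S P s} → FindPartition T K S P → Connected S → S s →
    Listing S (suc (length P))
  find-partition-listing (small single) _ Ss = listing-singleton Ss single
  find-partition-listing {S} (split {P₁ = P₁} {P₂} a b Sa Sb tab d₁ d₂) connected _ =
    subst (Listing S) size
      (listing-union (find-partition-listing d₁ side-connected (here Sa))
                     (find-partition-listing d₂ side-connected (here Sb))
                     sides-disjoint (sides-cover Sa Sb ∘ connected Sa) side⊆ side⊆)
    where
    open AtCut a b tab
    size : suc (length P₁) + suc (length P₂) ≡ suc (suc (length (P₁ ++ P₂)))
    size = cong suc (trans (+-suc (length P₁) (length P₂)) (cong suc (sym (length-++ P₁))))

  max-cliques-counted : ∀ {l} → Listing (λ _ → ⊤) l → NumMaxCliques (G ᶜ) l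
  max-cliques-counted nodes =
    map K elements , Unique.map⁺ K-injective unique , trans (length-map K elements) size ,
    λ C → listed C , maximal C
    where
    open Listing nodes
    listed : ∀ C → IsMaxClique (G ᶜ) C → C ∈ₗ map K elements
    listed C C-max with K-onto C C-max
    ... | x , refl = ∈-map⁺ K (complete tt)
    maximal : ∀ C → C ∈ₗ map K elements → IsMaxClique (G ᶜ) C
    maximal C C∈ with ∈-map⁻ K C∈
    ... | x , _ , refl = K-maximal x

-- Co-chordality of G only guarantees that a clique tree of Gᶜ exists;
-- here the clique tree is given.
theorem2 : ∀ (n : ℕ) (G : Adj (suc n)) → IsSimple G → IsCoChordal G →
    ∀ (m : ℕ) (T : Adj m) (K : Fin m → Subset (suc n)) → IsCliqueTree (G ᶜ) T K →
    ∀ (P : List (Biclique (suc n))) → FindPartition T K (λ _ → ⊤) P →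
    IsBicliquePartition G P × Σ ℕ (λ k → NumMaxCliques (G ᶜ) k × length P ≡ k ∸ 1)
theorem2 _ G (G-sym , G-irrefl) _ _ T K
  (((T-sym , T-irrefl) , T-connected , T-acyclic) , K-injective , K-maximal , K-onto , K-intersection) P fp =
  (bicliques , edges-covered-once) , suc (length P) , max-cliques-counted all-nodes , refl
  where
  open CliqueTree G-sym G-irrefl T-sym T-irrefl T-connected T-acyclic
                   K-injective K-maximal K-onto K-intersection
  open Tree T T-sym T-irrefl using (connected-⊤)

  bicliques : ∀ i → IsBicliqueOf G (lookup P i)
  bicliques i = All.lookup (find-partition-bicliques fp) (∈-lookup i)

  edges-covered-once : ∀ u v → G u v ≡ true →
    Σ _ λ i → EdgeIn (lookup P i) u v × (∀ j → EdgeIn (lookup P j) u v → j ≡ i)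
  edges-covered-once u v edge = ExactlyOne⇒unique-index
    (find-partition-exactly-one fp (connected-⊤ T-connected) edge (over-⊤ u) (over-⊤ v))

  all-nodes : Listing (λ _ → ⊤) (suc (length P))
  all-nodes = find-partition-listing {s = proj₁ (over-⊤ zero)} fp (connected-⊤ T-connected) tt
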